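{- Let $M$ be a connected matroid such that for every two distinct elements $x,y\in E(M)$ the partition $(\{x,y\},\{x,y\}^\complement)$ is a $2$-separation of $M$. Then $M$ is a circuit or a cocircuit.
   Context: Matroids are possibly infinite matroids in the sense of Bruhn, Diestel, Kriesell, Pendavingh and Wollan. $S^\complement=E(M)\setminus S$. Connected: every two elements lie in a common circuit. For a partition $(X,Y)$ of $E(M)$ pick bases $B_X$ of $M|X$, $B_Y$ of $M|Y$ and $F\subseteq B_X\cup B_Y$ with $(B_X\cup B_Y)\setminus F$ a base of $M$; $k=|F|$ depends only on $(X,Y)$; if $|X|,|Y|\ge k+1$, $(X,Y)$ is a $(k+1)$-separation. $M$ is a circuit (cocircuit) if $E(M)$ is a circuit of $M$ (of the dual $M^*$). -}

module Defs where

open import Level using (0ℓ)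
open import Data.Product using (Σ; ∃; ∃-syntax; _×_; _,_)
open import Data.Sum using (_⊎_)
open import Data.Empty using (⊥)
open import Relation.Nullary using (¬_)
open import Relation.Unary using (Pred; _∈_; _∉_; _⊆_; _∪_; _∩_; ∁; ∅; U)
open import Relation.Binary.PropositionalEquality using (_≡_; _≢_)

Subset : Set → Set₁
Subset E = Pred E 0ℓ

_∖_ : {E : Set} → Subset E → Subset E → Subset E
X ∖ Y = X ∩ ∁ Y

pair : {E : Set} → E → E → Subset E
pair x y = λ e → (e ≡ x) ⊎ (e ≡ y)

IsSingleton : {E : Set} → Subset E → Set
IsSingleton {E} F = ∃[ f ] (∀ (e : E) → (e ∈ F → e ≡ f) × (e ≡ f → e ∈ F))

AtLeastTwo : {E : Set} → Subset E → Set
AtLeastTwo X = ∃[ a ] ∃[ b ] (a ∈ X × b ∈ X × a ≢ b)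

module _ {E : Set} (Ind : Subset E → Set) where

  MaxIndIn : Subset E → Subset E → Set₁
  MaxIndIn X B = B ⊆ X × Ind B × (∀ J → Ind J → B ⊆ J → J ⊆ X → J ⊆ B)

  IsBaseOf : Subset E → Set₁
  IsBaseOf B = MaxIndIn U B

  IsCircuitOf : Subset E → Set₁
  IsCircuitOf C = ¬ Ind C × (∀ D → D ⊆ C → ¬ Ind D → C ⊆ D)

-- Infinite matroids (Bruhn–Diestel–Kriesell–Pendavingh–Wollan),
-- independence axioms (I1), (I2), (I3), (IM).
record Matroid (E : Set) : Set₁ where
  field
    Ind : Subset E → Set
    I1  : Ind ∅
    I2  : ∀ {I J} → Ind J → I ⊆ J → Ind I
    I3  : ∀ {I I'} → Ind I → ¬ IsBaseOf Ind I → IsBaseOf Ind I' →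
          ∃[ x ] (x ∈ I' × x ∉ I × Ind (λ e → e ∈ I ⊎ e ≡ x))
    IM  : ∀ {I X} → Ind I → I ⊆ X →
          Σ (Subset E) λ J → I ⊆ J × MaxIndIn Ind X J

module _ {E : Set} (M : Matroid E) where
  open Matroid M

  Base : Subset E → Set₁
  Base = IsBaseOf Ind

  BaseOfRestriction : Subset E → Subset E → Set₁
  BaseOfRestriction X = MaxIndIn Ind X

  Circuit : Subset E → Set₁
  Circuit = IsCircuitOf Ind

  IndDual : Subset E → Set₁
  IndDual I = Σ (Subset E) λ B → Base B × I ⊆ ∁ B

  Cocircuit : Subset E → Set₁
  Cocircuit C = ¬ IndDual C × (∀ D → D ⊆ C → ¬ IndDual D → C ⊆ D)

  Connected : Set₁
  Connected = ∀ x y → x ≢ y → Σ (Subset E) λ C → Circuit C × x ∈ C × y ∈ C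

  -- (X , Y) (Y = complement of X) is a 2-separation: k = |F| = 1 and |X|,|Y| ≥ 2
  IsTwoSeparation : Subset E → Subset E → Set₁
  IsTwoSeparation X Y =
    (Σ (Subset E) λ BX → Σ (Subset E) λ BY → Σ (Subset E) λ F →
        BaseOfRestriction X BX × BaseOfRestriction Y BY ×
        F ⊆ (BX ∪ BY) × Base ((BX ∪ BY) ∖ F) × IsSingleton F)
    × AtLeastTwo X × AtLeastTwo Y

  IsCircuitMatroid : Set₁
  IsCircuitMatroid = Circuit U

  IsCocircuitMatroid : Set₁
  IsCocircuitMatroid = Cocircuit U

-- Every 2-separation ({x , y} , {x , y}ᶜ) forces {x , y} to be dependent (x ∥ y) or
-- codependent (x, y in series).  A parallel pair {x , y} and a series pair {x , z}
-- with y ≠ z would meet a circuit and a cocircuit in the single element x, which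
-- is impossible once M has neither loops nor coloops (as connectivity guarantees
-- when |E| ≥ 2).  Hence a single series pair spreads to all pairs, and then E is a
-- circuit; otherwise all pairs are parallel and E is a cocircuit.
module Submission where

open import Defs
open import Level using (0ℓ; lift; lower)
open import Axiom.ExcludedMiddle using (ExcludedMiddle)
open import Function using (id)
open import Data.Sum using (_⊎_; inj₁; inj₂; [_,_]′)
open import Data.Product using (Σ; ∃-syntax; _×_; _,_; proj₁; proj₂)
open import Data.Empty using (⊥; ⊥-elim)
open import Data.Unit using (tt)
open import Relation.Nullary using (¬_; Dec; yes; no)
open import Relation.Nullary.Decidable using (map′)
open import Relation.Unary using (∁; _∈_; _∉_; _⊆_; _∪_; _≐_; U; ∅)
open import Relation.Binary.PropositionalEquality
  using (_≡_; _≢_; refl; sym; trans; subst; ≢-sym)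

module _ {E : Set} where

  single : E → Subset E
  single z = λ e → e ≡ z

  insert : E → Subset E → Subset E
  insert x I = λ e → e ∈ I ⊎ e ≡ x

  pair-comm : ∀ {x y : E} → pair x y ⊆ pair y x
  pair-comm (inj₁ e≡x) = inj₂ e≡x
  pair-comm (inj₂ e≡y) = inj₁ e≡y

  other-in-pair : ∀ {x y w : E} → x ≢ y → w ∈ pair x y → Σ E λ o → o ∈ pair x y × o ≢ w
  other-in-pair x≢y (inj₁ refl) = _ , inj₂ refl , ≢-sym x≢y
  other-in-pair x≢y (inj₂ refl) = _ , inj₁ refl , x≢y

module _ {E : Set} (M : Matroid E) where
  open Matroid M

  Base⇒Ind : ∀ {B} → Base M B → Ind B
  Base⇒Ind (_ , indB , _) = indB

  Base-maximal : ∀ {B J} → Base M B → Ind J → B ⊆ J → J ⊆ B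
  Base-maximal (_ , _ , maximal) indJ B⊆J = maximal _ indJ B⊆J (λ _ → tt)

  Base-resp-≐ : ∀ {B B′} → Base M B → B ≐ B′ → Base M B′
  Base-resp-≐ bB (B⊆B′ , B′⊆B) =
    (λ _ → tt) , I2 (Base⇒Ind bB) B′⊆B ,
    λ J indJ B′⊆J _ e∈J → B⊆B′ (Base-maximal bB indJ (λ e∈B → B′⊆J (B⊆B′ e∈B)) e∈J)

  base-exists : Σ (Subset E) (Base M)
  base-exists with IM {∅} {U} I1 (λ ())
  ... | B , _ , bB = B , bB

  MaxIndIn-closed : ∀ {X J v} → MaxIndIn Ind X J → Ind (insert v J) → v ∈ X → v ∈ J
  MaxIndIn-closed {X} {J} {v} (J⊆X , _ , maximal) indJv v∈X =
    maximal (insert v J) indJv inj₁ Jv⊆X (inj₂ refl)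
    where
    Jv⊆X : insert v J ⊆ X
    Jv⊆X (inj₁ e∈J) = J⊆X e∈J
    Jv⊆X (inj₂ refl) = v∈X

  Parallel : E → E → Set
  Parallel x y = ¬ Ind (pair x y)

  Series : E → E → Set₁
  Series x y = ∀ B → Base M B → ¬ B ⊆ ∁ (pair x y)

  Series-sym : ∀ {x y : E} → Series x y → Series y x
  Series-sym s B bB B⊆ = s B bB (λ e∈B e∈xy → B⊆ e∈B (pair-comm e∈xy))

  NonLoop : E → Set
  NonLoop z = Ind (single z)

  NonColoop : E → Set₁
  NonColoop z = Σ (Subset E) λ B → Base M B × z ∉ B

module Classical (em : ExcludedMiddle (Level.suc 0ℓ)) where

  dec : (P : Set) → Dec P
  dec P = map′ lower lift em

  module _ {E : Set} (M : Matroid E) where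
    open Matroid M

    MaxIndIn-base : ∀ {X J B} → MaxIndIn Ind X J → Base M B → B ⊆ X → Base M J
    MaxIndIn-base {J = J} mJ@(_ , indJ , _) bB B⊆X with em {Base M J}
    ... | yes bJ = bJ
    ... | no ¬bJ with I3 indJ ¬bJ bB
    ...   | v , v∈B , v∉J , indJv = ⊥-elim (v∉J (MaxIndIn-closed M mJ indJv (B⊆X v∈B)))

    Series⇒∈base : ∀ {x w B} → Series M x w → Base M B → x ∉ B → w ∈ B
    Series⇒∈base {x} {w} {B} s bB x∉B with dec (w ∈ B)
    ... | yes w∈B = w∈B
    ... | no w∉B = ⊥-elim (s B bB B⊆∁xw)
      where
      B⊆∁xw : B ⊆ ∁ (pair x w)
      B⊆∁xw e∈B (inj₁ refl) = x∉B e∈B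
      B⊆∁xw e∈B (inj₂ refl) = w∉B e∈B

    circuit-delete-Ind : ∀ {C z} → Circuit M C → z ∈ C → Ind (C ∖ single z)
    circuit-delete-Ind {C} {z} (_ , minimal) z∈C with dec (Ind (C ∖ single z))
    ... | yes ind = ind
    ... | no dep = ⊥-elim (proj₂ (minimal _ proj₁ dep z∈C) refl)

    circuit-NonLoop : ∀ {C a b} → Circuit M C → a ∈ C → b ∈ C → a ≢ b → NonLoop M a
    circuit-NonLoop {C} {a} (_ , minimal) a∈C b∈C a≢b with dec (Ind (single a))
    ... | yes ind = ind
    ... | no dep = ⊥-elim (a≢b (sym (minimal (single a) (λ { refl → a∈C }) dep b∈C)))

    -- C ∖ z extends to a maximal independent J in E ∖ z; a base J + z would contain C.
    circuit-NonColoop : ∀ {C z} → Circuit M C → z ∈ C → NonColoop M z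
    circuit-NonColoop {C} {z} cC@(depC , _) z∈C with IM (circuit-delete-Ind cC z∈C) proj₂
    ... | J , C∖z⊆J , mJ@(J⊆∁z , indJ , _) = J , bJ , λ z∈J → J⊆∁z z∈J refl
      where
      bJ : Base M J
      bJ with em {Base M J}
      ... | yes b = b
      ... | no ¬bJ with I3 indJ ¬bJ (proj₂ (base-exists M))
      ...   | v , _ , v∉J , indJv with dec (v ≡ z)
      ...     | no v≢z = ⊥-elim (v∉J (MaxIndIn-closed M mJ indJv v≢z))
      ...     | yes refl = ⊥-elim (depC (I2 indJv C⊆Jv))
        where
        C⊆Jv : C ⊆ insert v J
        C⊆Jv {c} c∈C with dec (c ≡ v)
        ... | yes c≡v = inj₂ c≡v
        ... | no c≢v = inj₁ (C∖z⊆J (c∈C , c≢v))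

    exchange-Base : ∀ {B f z} → Base M B → f ∈ B → z ∉ B →
                    Ind (insert z (B ∖ single f)) → Base M (insert z (B ∖ single f))
    exchange-Base {B} {f} {z} bB f∈B z∉B indK with em {Base M (insert z (B ∖ single f))}
    ... | yes bK = bK
    ... | no ¬bK with I3 indK ¬bK bB
    ...   | v , v∈B , v∉K , indKv with dec (v ≡ f)
    ...     | no v≢f = ⊥-elim (v∉K (inj₁ (v∈B , v≢f)))
    ...     | yes refl = ⊥-elim (z∉B (Base-maximal M bB indKv B⊆Kv (inj₁ (inj₂ refl))))
      where
      B⊆Kv : B ⊆ insert v (insert z (B ∖ single v))
      B⊆Kv {e} e∈B with dec (e ≡ v)
      ... | yes e≡v = inj₂ e≡v
      ... | no e≢v = inj₁ (inj₁ (e∈B , e≢v))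

    base-exchange : ∀ {B B′ f} → Base M B → f ∈ B → Base M B′ → f ∉ B′ →
                    ∃[ z ] (z ∈ B′ × z ∉ B × Base M (insert z (B ∖ single f)))
    base-exchange {B} {B′} {f} bB f∈B bB′ f∉B′
      with I3 (I2 (Base⇒Ind M bB) proj₁) B∖f-nonbase bB′
      where
      B∖f-nonbase : ¬ Base M (B ∖ single f)
      B∖f-nonbase bB∖f = proj₂ (Base-maximal M bB∖f (Base⇒Ind M bB) proj₁ f∈B) refl
    ... | z , z∈B′ , z∉B∖f , indK = z , z∈B′ , z∉B , exchange-Base bB f∈B z∉B indK
      where
      z∉B : z ∉ B
      z∉B z∈B = z∉B∖f (z∈B , λ { refl → f∉B′ z∈B′ })

    -- If {x , y} ∪ BY minus one element is a base, the maximal independent BY ⊆ {x , y}ᶜ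
    -- has corank one, so it cannot itself be a base.
    complement-not-Base : ∀ {x y f BY} → x ≢ y → MaxIndIn Ind (∁ (pair x y)) BY →
                          f ∈ pair x y ∪ BY → Base M ((pair x y ∪ BY) ∖ single f) → ¬ Base M BY
    complement-not-Base {x} {y} {f} {BY} x≢y (BY⊆∁X , _) (inj₁ f∈X) bB bBY
      with other-in-pair x≢y f∈X
    ... | o , o∈X , o≢f = BY⊆∁X (Base-maximal M bBY (Base⇒Ind M bB) BY⊆B (inj₁ o∈X , o≢f)) o∈X
      where
      BY⊆B : BY ⊆ (pair x y ∪ BY) ∖ single f
      BY⊆B e∈BY = inj₂ e∈BY , λ { refl → BY⊆∁X e∈BY f∈X }
    complement-not-Base {x} {y} {f} {BY} x≢y (BY⊆∁X , _) (inj₂ f∈BY) bB bBY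
      with base-exchange bBY f∈BY bB (λ f∈B → proj₂ f∈B refl)
    ... | z , (z∈X∪BY , z≢f) , z∉BY , bK with z∈X∪BY
    ...   | inj₂ z∈BY = z∉BY z∈BY
    ...   | inj₁ z∈X with other-in-pair x≢y z∈X
    ...     | o , o∈X , o≢z
              with Base-maximal M bK (Base⇒Ind M bB) K⊆B (inj₁ o∈X , λ { refl → BY⊆∁X f∈BY o∈X })
      where
      K⊆B : insert z (BY ∖ single f) ⊆ (pair x y ∪ BY) ∖ single f
      K⊆B (inj₁ (e∈BY , e≢f)) = inj₂ e∈BY , e≢f
      K⊆B (inj₂ refl) = inj₁ z∈X , z≢f
    ...       | inj₁ (o∈BY , _) = BY⊆∁X o∈BY o∈X
    ...       | inj₂ o≡z = o≢z o≡z

    IsTwoSeparation⇒Parallel⊎Series : ∀ {x y} → x ≢ y →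
                                      IsTwoSeparation M (pair x y) (∁ (pair x y)) →
                                      Parallel M x y ⊎ Series M x y
    IsTwoSeparation⇒Parallel⊎Series {x} {y} x≢y ((BX , BY , F , mX , mY , F⊆ , bB , f , F≐f) , _)
      with dec (Ind (pair x y))
    ... | no dep = inj₁ dep
    ... | yes ind = inj₂ λ B′ bB′ B′⊆∁X →
          complement-not-Base x≢y mY f∈X∪BY (Base-resp-≐ M bB (⊆X∪BY∖f , ⊇X∪BY∖f))
                              (MaxIndIn-base mY bB′ B′⊆∁X)
      where
      X⊆BX : pair x y ⊆ BX
      X⊆BX = proj₂ (proj₂ mX) _ ind (proj₁ mX) id
      BX∪BY⊆X∪BY : BX ∪ BY ⊆ pair x y ∪ BY
      BX∪BY⊆X∪BY = [ (λ e∈BX → inj₁ (proj₁ mX e∈BX)) , inj₂ ]′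
      f∈X∪BY : f ∈ pair x y ∪ BY
      f∈X∪BY = BX∪BY⊆X∪BY (F⊆ (proj₂ (F≐f f) refl))
      ⊆X∪BY∖f : (BX ∪ BY) ∖ F ⊆ (pair x y ∪ BY) ∖ single f
      ⊆X∪BY∖f (e∈BX∪BY , e∉F) = BX∪BY⊆X∪BY e∈BX∪BY , λ e≡f → e∉F (proj₂ (F≐f _) e≡f)
      ⊇X∪BY∖f : (pair x y ∪ BY) ∖ single f ⊆ (BX ∪ BY) ∖ F
      ⊇X∪BY∖f (e∈X∪BY , e≢f) = [ (λ e∈X → inj₁ (X⊆BX e∈X)) , inj₂ ]′ e∈X∪BY ,
                                λ e∈F → e≢f (proj₁ (F≐f _) e∈F)

    -- x ∉ J since x ∥ y ∈ J, so J is still maximal after adding x to the ambient set.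
    MaxIndIn-adjoin-parallel : ∀ {X Y J x y} → MaxIndIn Ind X J → y ∈ J → Parallel M x y →
                               J ⊆ Y → (∀ {e} → e ∈ Y → e ≢ x → e ∈ X) → MaxIndIn Ind Y J
    MaxIndIn-adjoin-parallel {Y = Y} {J} {x} {y} (_ , indJ , maximal) y∈J par J⊆Y Y∖x⊆X =
      J⊆Y , indJ , maximal′
      where
      pair⊆ : ∀ {K} → x ∈ K → y ∈ K → pair x y ⊆ K
      pair⊆ x∈K _ (inj₁ refl) = x∈K
      pair⊆ _ y∈K (inj₂ refl) = y∈K
      maximal′ : ∀ K → Ind K → J ⊆ K → K ⊆ Y → K ⊆ J
      maximal′ K indK J⊆K K⊆Y {k} k∈K with dec (k ≡ x)
      ... | yes refl = ⊥-elim (par (I2 indK (pair⊆ k∈K (J⊆K y∈J))))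
      ... | no k≢x = maximal (K ∖ single x) (I2 indK proj₁)
                       (λ e∈J → J⊆K e∈J , λ { refl → par (I2 indJ (pair⊆ e∈J y∈J)) })
                       (λ (e∈K , e≢x) → Y∖x⊆X (K⊆Y e∈K) e≢x) (k∈K , k≢x)

    -- A circuit and a cocircuit never meet in exactly one element.
    Parallel-Series-orthogonal : ∀ {x y z} → NonLoop M y → NonColoop M z →
                                 Parallel M x y → Series M x z → y ≢ x → y ≢ z → ⊥
    Parallel-Series-orthogonal {x} {y} {z} nonLoop (B , bB , z∉B) par ser y≢x y≢z
      with IM nonLoop y∈∁xz
      where
      y∈∁xz : single y ⊆ ∁ (pair x z)
      y∈∁xz refl (inj₁ refl) = y≢x refl
      y∈∁xz refl (inj₂ refl) = y≢z refl
    ... | J , y∈J , mJ@(J⊆∁xz , _) = ser J (MaxIndIn-base mJ′ bB B⊆∁z) J⊆∁xz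
      where
      B⊆∁z : B ⊆ ∁ (single z)
      B⊆∁z e∈B refl = z∉B e∈B
      mJ′ : MaxIndIn Ind (∁ (single z)) J
      mJ′ = MaxIndIn-adjoin-parallel mJ (y∈J refl) par (λ e∈J e≡z → J⊆∁xz e∈J (inj₂ e≡z))
              λ e≢z e≢x → [ e≢x , e≢z ]′

    U-Circuit : (∀ e → NonColoop M e) → ¬ Ind U → (∀ a b → a ≢ b → Series M a b) → Circuit M U
    U-Circuit nonColoop depU series = depU , minimal
      where
      minimal : ∀ D → D ⊆ U → ¬ Ind D → U ⊆ D
      minimal D _ depD {e} _ with dec (e ∈ D) | nonColoop e
      ... | yes e∈D | _ = e∈D
      ... | no e∉D | B , bB , e∉B = ⊥-elim (depD (I2 (Base⇒Ind M bB) D⊆B))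
        where
        D⊆B : D ⊆ B
        D⊆B {d} d∈D = Series⇒∈base (series e d λ { refl → e∉D d∈D }) bB e∉B

    singleton-Base : ∀ {e} → NonLoop M e → (∀ w → e ≢ w → Parallel M e w) → Base M (single e)
    singleton-Base {e} nonLoop parallel = (λ _ → tt) , nonLoop , maximal
      where
      maximal : ∀ J → Ind J → single e ⊆ J → J ⊆ U → J ⊆ single e
      maximal J indJ e∈J _ {j} j∈J with dec (j ≡ e)
      ... | yes j≡e = j≡e
      ... | no j≢e = ⊥-elim (parallel j (≢-sym j≢e) (I2 indJ [ e∈J , (λ { refl → j∈J }) ]′))

    U-Cocircuit : (∀ e → NonLoop M e) → E → (∀ a b → a ≢ b → Parallel M a b) → Cocircuit M U
    U-Cocircuit nonLoop e₀ parallel = codepU , minimal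
      where
      codepU : ¬ IndDual M U
      codepU (B , bB , U⊆∁B) =
        U⊆∁B tt (Base-maximal M bB (nonLoop e₀) (λ e∈B → ⊥-elim (U⊆∁B tt e∈B)) refl)
      minimal : ∀ D → D ⊆ U → ¬ IndDual M D → U ⊆ D
      minimal D _ codepD {e} _ with dec (e ∈ D)
      ... | yes e∈D = e∈D
      ... | no e∉D = ⊥-elim (codepD (single e , singleton-Base (nonLoop e) (parallel e) ,
                                     λ { d∈D refl → e∉D d∈D }))

    subsingleton-Circuit⊎Cocircuit : E → (∀ (a b : E) → a ≡ b) → Circuit M U ⊎ Cocircuit M U
    subsingleton-Circuit⊎Cocircuit e₀ all≡ with dec (Ind U)
    ... | yes indU = inj₂ (U-Cocircuit (λ _ → I2 indU _) e₀ λ a b a≢b → ⊥-elim (a≢b (all≡ a b)))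
    ... | no depU = inj₁ (U-Circuit nonColoop depU λ a b a≢b → ⊥-elim (a≢b (all≡ a b)))
      where
      nonColoop : ∀ e → NonColoop M e
      nonColoop e with base-exists M
      ... | B , bB = B , bB , λ e∈B → depU (I2 (Base⇒Ind M bB) λ {d} _ → subst B (all≡ e d) e∈B)

    connected-circuit-through : Connected M → ∀ {a b} → a ≢ b → ∀ z →
      Σ (Subset E) λ C → ∃[ w ] (Circuit M C × z ∈ C × w ∈ C × z ≢ w)
    connected-circuit-through conn {a} {b} a≢b z with dec (z ≡ a)
    ... | yes refl with conn z b a≢b
    ...   | C , cC , z∈C , b∈C = C , b , cC , z∈C , b∈C , a≢b
    connected-circuit-through conn {a} a≢b z | no z≢a with conn z a z≢a
    ...   | C , cC , z∈C , a∈C = C , a , cC , z∈C , a∈C , z≢a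

    module _ (nonLoop : ∀ z → NonLoop M z) (nonColoop : ∀ z → NonColoop M z)
             (parallel⊎series : ∀ a b → a ≢ b → Parallel M a b ⊎ Series M a b) where

      Series-spread : ∀ {p q r} → Series M p q → p ≢ r → Series M p r
      Series-spread {p} {q} {r} s p≢r with dec (r ≡ q) | parallel⊎series p r p≢r
      ... | yes refl | _ = s
      ... | no _ | inj₂ s′ = s′
      ... | no r≢q | inj₁ par =
            ⊥-elim (Parallel-Series-orthogonal (nonLoop r) (nonColoop q) par s (≢-sym p≢r) r≢q)

      Series-everywhere : ∀ {x z} → Series M x z → ∀ a b → a ≢ b → Series M a b
      Series-everywhere {x} s a b a≢b with dec (a ≡ x)
      ... | yes refl = Series-spread s a≢b
      ... | no a≢x = Series-spread (Series-sym M (Series-spread s (≢-sym a≢x))) a≢b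

      Circuit⊎Cocircuit : E → ¬ Ind U → Circuit M U ⊎ Cocircuit M U
      Circuit⊎Cocircuit e₀ depU with em {∃[ x ] ∃[ z ] (x ≢ z × Series M x z)}
      ... | yes (_ , _ , _ , s) = inj₁ (U-Circuit nonColoop depU (Series-everywhere s))
      ... | no ∄series = inj₂ (U-Cocircuit nonLoop e₀ λ a b a≢b →
            [ id , (λ s → ⊥-elim (∄series (a , b , a≢b , s))) ]′ (parallel⊎series a b a≢b))

open Classical

mainTheorem6 : ExcludedMiddle (Level.suc 0ℓ) →
    {E : Set} → E → (M : Matroid E) → Connected M →
    (∀ (x y : E) → x ≢ y → IsTwoSeparation M (pair x y) (∁ (pair x y))) →
    IsCircuitMatroid M ⊎ IsCocircuitMatroid M
mainTheorem6 em {E} e₀ M conn sep with dec em (∃[ y ] y ≢ e₀)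
... | no ∄y = subsingleton-Circuit⊎Cocircuit em M e₀ λ a b → trans (≡e₀ a) (sym (≡e₀ b))
  where
  ≡e₀ : ∀ e → e ≡ e₀
  ≡e₀ e with dec em (e ≡ e₀)
  ... | yes e≡e₀ = e≡e₀
  ... | no e≢e₀ = ⊥-elim (∄y (e , e≢e₀))
... | yes (y , y≢e₀) =
      Circuit⊎Cocircuit em M nonLoop nonColoop parallel⊎series e₀ depU
  where
  open Matroid M
  through : ∀ z → Σ (Subset E) λ C → ∃[ w ] (Circuit M C × z ∈ C × w ∈ C × z ≢ w)
  through = connected-circuit-through em M conn y≢e₀
  nonLoop : ∀ z → NonLoop M z
  nonLoop z with through z
  ... | _ , _ , cC , z∈C , w∈C , z≢w = circuit-NonLoop em M cC z∈C w∈C z≢w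
  nonColoop : ∀ z → NonColoop M z
  nonColoop z with through z
  ... | _ , _ , cC , z∈C , _ = circuit-NonColoop em M cC z∈C
  depU : ¬ Ind U
  depU indU with through e₀
  ... | _ , _ , (depC , _) , _ = depC (I2 indU _)
  parallel⊎series : ∀ a b → a ≢ b → Parallel M a b ⊎ Series M a b
  parallel⊎series a b a≢b = IsTwoSeparation⇒Parallel⊎Series em M a≢b (sep a b a≢b)
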